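{- Let $X\subseteq\omega$ be an infinite set with uniqueness of sums and let $p\in\beta\omega$ be an $X$-adequate ultrafilter. Then every element of $\mathscr F^p$ is $X$-adequate.
   Context: $\mathrm{FS}(A)$ is the set of sums of finite nonempty subsets of $A$. $A\subseteq\omega$ has uniqueness of sums if whenever $a_1<\dots<a_n$, $b_1<\dots<b_m$ in $A$ have equal sums, $n=m$ and $a_i=b_i$. For infinite $X$ with increasing enumeration $\langle x_n\rangle$, $A$ is $X$-adequate if $A\subseteq\mathrm{FS}(X)$ and for every subsequence $\langle x_{n_k}: k\ge1\rangle$ there is a unique $m\ge1$ with $x_{n_1}+\dots+x_{n_m}\in A$; an ultrafilter $u$ is $X$-adequate if some $X$-adequate set is in $u$ and $\mathrm{FS}(Y)\in u$ for every cofinite $Y\subseteq X$. $\bigoplus_u u_n=\{A\subseteq\omega : \{n : \{m : n+m\in A\}\in u_n\}\in u\}$. $\mathscr F^p_0=\{p\}$, $\mathscr F^p_{\alpha+1}=\{\bigoplus_u u_n : u,u_n\in\mathscr F^p_\alpha\}$, $\mathscr F^p_\alpha=\bigcup_{\xi<\alpha}\mathscr F^p_\xi$ for limit $\alpha$, $\mathscr F^p=\bigcup_\alpha\mathscr F^p_\alpha$. -}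

module Defs where

open import Data.Nat using (ℕ; zero; suc; _+_; _≤_; _<_)
open import Data.List using (List; []; _∷_)
open import Data.Nat.ListAction using (sum)
open import Data.List.Relation.Unary.All using (All)
open import Data.List.Relation.Unary.Linked using (Linked)
open import Data.Product using (Σ; ∃; _×_; _,_)
open import Data.Sum using (_⊎_)
open import Data.Unit using (⊤)
open import Data.Empty using (⊥)
open import Relation.Nullary using (¬_)
open import Relation.Binary.PropositionalEquality using (_≡_; _≢_)

Subset : Set₁
Subset = ℕ → Set

SetFamily : Set₁
SetFamily = Subset → Set

record IsUltrafilter (U : SetFamily) : Set₁ where
  field
    full    : U (λ _ → ⊤)
    proper  : ¬ U (λ _ → ⊥)
    upward  : (A B : Subset) → (∀ n → A n → B n) → U A → U B
    meet    : (A B : Subset) → U A → U B → U (λ n → A n × B n)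
    ultra   : (A : Subset) → U A ⊎ U (λ n → ¬ A n)

-- finite nonempty subsets of Y, written as strictly increasing nonempty lists
FinNESub : Subset → List ℕ → Set
FinNESub Y l = (l ≢ []) × Linked _<_ l × All Y l

FS : Subset → Subset
FS Y a = Σ (List ℕ) λ l → FinNESub Y l × sum l ≡ a

UniquenessOfSums : Subset → Set
UniquenessOfSums Y = (as bs : List ℕ) → FinNESub Y as → FinNESub Y bs →
  sum as ≡ sum bs → as ≡ bs

StrictlyIncreasing : (ℕ → ℕ) → Set
StrictlyIncreasing f = ∀ i j → i < j → f i < f j

-- the infinite set X with increasing enumeration x : X = range x
range : (ℕ → ℕ) → Subset
range x a = ∃ λ i → x i ≡ a

psum : (ℕ → ℕ) → ℕ → ℕ
psum f zero = 0
psum f (suc m) = psum f m + f m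

-- Subsequences ⟨x_{n_k}⟩ are given by strictly increasing n; the sum
-- x_{n_1}+...+x_{n_m} is psum (λ k → x (n k)) m  (indices shifted to start at 0).
Adequate : (ℕ → ℕ) → Subset → Set
Adequate x A =
  (∀ a → A a → FS (range x) a) ×
  ((n : ℕ → ℕ) → StrictlyIncreasing n →
     Σ ℕ λ m → (1 ≤ m) × A (psum (λ k → x (n k)) m) ×
       (∀ m′ → 1 ≤ m′ → A (psum (λ k → x (n k)) m′) → m′ ≡ m))

CofiniteSubset : Subset → Subset → Set
CofiniteSubset Y X = (∀ a → Y a → X a) × (∃ λ N → ∀ a → X a → N ≤ a → Y a)

AdequateUF : (ℕ → ℕ) → SetFamily → Set₁
AdequateUF x u =
  (Σ Subset λ A → Adequate x A × u A) ×
  ((Y : Subset) → CofiniteSubset Y (range x) → u (FS Y))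

⊕ : SetFamily → (ℕ → SetFamily) → SetFamily
⊕ u us A = u (λ n → us n (λ m → A (n + m)))

-- F^p = ⋃_α F^p_α, i.e. the least family containing p and closed under
-- (u, ⟨u_n⟩) ↦ ⊕_u u_n
data InF (p : SetFamily) : SetFamily → Set₁ where
  base : InF p p
  step : (u : SetFamily) (us : ℕ → SetFamily) →
         InF p u → (∀ n → InF p (us n)) → InF p (⊕ u us)

{-# OPTIONS --safe #-}
-- A sum ⊕_u u_n of ultrafilters is an ultrafilter, so by induction along F^p it suffices
-- to show that ⊕_u u_n is X-adequate when u and all u_n are. Take X-adequate A ∈ u and
-- A_n ∈ u_n, and let B consist of the sums of s ++ t where s < t are finite sets from X
-- with Σ s ∈ A and Σ t ∈ A_{Σ s}. Since each u_n contains FS(X ∖ [0, n]), B ∈ ⊕_u u_n,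
-- and the same argument puts FS(Y) in ⊕_u u_n for cofinite Y ⊆ X. Along a subsequence
-- of X, a partial sum lies in B for the initial block whose sum is in A followed by the
-- next block whose sum is in A_a; by uniqueness of sums any representation of a partial
-- sum in B is of this form, so adequacy of A and of A_a makes it unique.
module Submission where

open import Defs
open import Data.Nat using (ℕ; zero; suc; _+_; _≤_; _<_; z≤n; s≤s)
open import Data.Nat.Properties
  using (≤-trans; ≤-<-trans; m≤m+n; m≤n+m; n<1+n; +-identityʳ; +-monoʳ-<; m+n≤o⇒m≤o; m+n≤o⇒n≤o)
open import Data.Nat.ListAction using (sum)
open import Data.Nat.ListAction.Properties using (sum-++)
open import Data.List using (List; []; _∷_; _++_; [_]; _∷ʳ_; length; last; applyUpTo)
open import Data.List.Properties using (∷-injective; length-++; length-applyUpTo; applyUpTo-∷ʳ)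
open import Data.List.Relation.Unary.All as All using (_∷_)
import Data.List.Relation.Unary.All.Properties as All
import Data.List.Relation.Unary.Linked.Properties as Linked
open import Data.Maybe using (just)
open import Data.Maybe.Relation.Binary.Connected using (Connected; just; nothing-just)
open import Data.Product using (Σ; _×_; _,_; proj₁; proj₂)
import Data.Product as Product
open import Data.Sum using (_⊎_; inj₁; inj₂)
open import Data.Empty using (⊥-elim)
open import Function using (_∘_)
open import Relation.Nullary using (¬_)
open import Relation.Binary.PropositionalEquality
  using (_≡_; _≢_; refl; sym; trans; cong; cong₂; subst; subst₂; module ≡-Reasoning)
open ≡-Reasoning

Above : ℕ → Subset → Subset
Above n Y a = Y a × n < a

CofiniteSubset-refl : (X : Subset) → CofiniteSubset X X
CofiniteSubset-refl X = (λ _ Xa → Xa) , 0 , λ _ Xa _ → Xa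

Above-cofinite : ∀ {Y X} n → CofiniteSubset Y X → CofiniteSubset (Above n Y) X
Above-cofinite n (Y⊆X , N , X≥N⊆Y) =
  (λ a → Y⊆X a ∘ proj₁) ,
  N + suc n , λ a Xa N+n<a → X≥N⊆Y a Xa (m+n≤o⇒m≤o N N+n<a) , m+n≤o⇒n≤o N N+n<a

∘-strictlyIncreasing : ∀ {f g} → StrictlyIncreasing f → StrictlyIncreasing g →
  StrictlyIncreasing (f ∘ g)
∘-strictlyIncreasing f↑ g↑ i j i<j = f↑ _ _ (g↑ i j i<j)

+-strictlyIncreasing : ∀ k → StrictlyIncreasing (k +_)
+-strictlyIncreasing k i j = +-monoʳ-< k

last-connected : ∀ xs {b} → sum xs < b → Connected _<_ (last xs) (just b)
last-connected []           _   = nothing-just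
last-connected (x ∷ [])     x<b = just (≤-<-trans (m≤m+n x 0) x<b)
last-connected (x ∷ y ∷ xs) s<b = last-connected (y ∷ xs) (≤-<-trans (m≤n+m _ x) s<b)

FinNESub-++ : ∀ {Y xs ys} → FinNESub Y xs → FinNESub (Above (sum xs) Y) ys →
  FinNESub Y (xs ++ ys)
FinNESub-++ {xs = []}    (xs≢[] , _) _           = ⊥-elim (xs≢[] refl)
FinNESub-++ {ys = []}    _           (ys≢[] , _) = ⊥-elim (ys≢[] refl)
FinNESub-++ {xs = x ∷ xs} {ys = _ ∷ _} (_ , xs↑ , Yxs) (_ , ys↑ , Ays@((_ , s<y) ∷ _)) =
  (λ ()) , Linked.++⁺ xs↑ (last-connected (x ∷ xs) s<y) ys↑ , All.++⁺ Yxs (All.map proj₁ Ays)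

FS-+ : ∀ {Y m n} → FS Y m → FS (Above m Y) n → FS Y (m + n)
FS-+ (xs , xs∈ , refl) (ys , ys∈ , refl) = xs ++ ys , FinNESub-++ xs∈ ys∈ , sum-++ xs ys

sum-applyUpTo : ∀ g m → sum (applyUpTo g m) ≡ psum g m
sum-applyUpTo g zero    = refl
sum-applyUpTo g (suc m) = begin
  sum (applyUpTo g (suc m))       ≡⟨ cong sum (applyUpTo-∷ʳ g m) ⟨
  sum (applyUpTo g m ∷ʳ g m)      ≡⟨ sum-++ (applyUpTo g m) [ g m ] ⟩
  sum (applyUpTo g m) + (g m + 0) ≡⟨ cong₂ _+_ (sum-applyUpTo g m) (+-identityʳ (g m)) ⟩
  psum g m + g m                  ∎

applyUpTo-++ : ∀ {A : Set} (g : ℕ → A) i j →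
  applyUpTo g (i + j) ≡ applyUpTo g i ++ applyUpTo (g ∘ (i +_)) j
applyUpTo-++ g zero    j = refl
applyUpTo-++ g (suc i) j = cong (g 0 ∷_) (applyUpTo-++ (g ∘ suc) i j)

applyUpTo-++⁻ : ∀ {A : Set} (g : ℕ → A) xs ys {m} → xs ++ ys ≡ applyUpTo g m →
  xs ≡ applyUpTo g (length xs) × ys ≡ applyUpTo (g ∘ (length xs +_)) (length ys)
applyUpTo-++⁻ g []       ys {m}     refl = refl , cong (applyUpTo g) (sym (length-applyUpTo g m))
applyUpTo-++⁻ g (x ∷ xs) ys {suc m} eq with ∷-injective eq
... | refl , eq′ = Product.map₁ (cong (g 0 ∷_)) (applyUpTo-++⁻ (g ∘ suc) xs ys eq′)

applyUpTo-≢[] : ∀ {A : Set} (g : ℕ → A) {m} → 1 ≤ m → applyUpTo g m ≢ []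
applyUpTo-≢[] g {suc m} _ ()

≢[]⇒1≤length : ∀ {A : Set} {xs : List A} → xs ≢ [] → 1 ≤ length xs
≢[]⇒1≤length {xs = []}    xs≢[] = ⊥-elim (xs≢[] refl)
≢[]⇒1≤length {xs = _ ∷ _} _     = s≤s z≤n

applyUpTo-FinNESub : ∀ {X g} → (∀ k → X (g k)) → StrictlyIncreasing g →
  ∀ {m} → 1 ≤ m → FinNESub X (applyUpTo g m)
applyUpTo-FinNESub {g = g} Xg g↑ {m} 1≤m =
  applyUpTo-≢[] g 1≤m ,
  Linked.applyUpTo⁺₂ g m (λ i → g↑ i (suc i) (n<1+n i)) ,
  All.applyUpTo⁺₂ g m Xg

UniquenessOfSums⇒≡applyUpTo : ∀ {X g} → UniquenessOfSums X →
  (∀ k → X (g k)) → StrictlyIncreasing g →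
  ∀ {xs m} → 1 ≤ m → FinNESub X xs → sum xs ≡ psum g m → xs ≡ applyUpTo g m
UniquenessOfSums⇒≡applyUpTo {g = g} uos Xg g↑ {xs} {m} 1≤m xs∈ xs≡ =
  uos xs (applyUpTo g m) xs∈ (applyUpTo-FinNESub Xg g↑ 1≤m)
    (trans xs≡ (sym (sum-applyUpTo g m)))

⊕-isUltrafilter : ∀ {u us} → IsUltrafilter u → (∀ n → IsUltrafilter (us n)) →
  IsUltrafilter (⊕ u us)
⊕-isUltrafilter {u} {us} u-uf us-uf = record
  { full   = upward u-uf _ _ (λ n _ → full (us-uf n)) (full u-uf)
  ; proper = λ ⊕∋∅ → proper u-uf (upward u-uf _ _ (λ n → proper (us-uf n)) ⊕∋∅)
  ; upward = λ A B A⊆B → upward u-uf _ _ (λ n → upward (us-uf n) _ _ (λ m → A⊆B (n + m)))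
  ; meet   = λ A B ⊕∋A ⊕∋B →
      upward u-uf _ _ (λ n (us∋A , us∋B) → meet (us-uf n) _ _ us∋A us∋B) (meet u-uf _ _ ⊕∋A ⊕∋B)
  ; ultra  = ultra′
  }
  where
  open IsUltrafilter

  ultra′ : (A : Subset) → ⊕ u us A ⊎ ⊕ u us (λ n → ¬ A n)
  ultra′ A with ultra u-uf (λ n → us n (λ m → A (n + m)))
  ... | inj₁ ⊕∋A = inj₁ ⊕∋A
  ... | inj₂ u∋∁ = inj₂ (upward u-uf _ _ complement u∋∁)
    where
    complement : ∀ n → ¬ us n (λ m → A (n + m)) → us n (λ m → ¬ A (n + m))
    complement n us∌A with ultra (us-uf n) (λ m → A (n + m))
    ... | inj₁ us∋A  = ⊥-elim (us∌A us∋A)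
    ... | inj₂ us∋∁A = us∋∁A

InF⇒isUltrafilter : ∀ {p q} → IsUltrafilter p → InF p q → IsUltrafilter q
InF⇒isUltrafilter p-uf base                   = p-uf
InF⇒isUltrafilter p-uf (step u us u∈F us∈F) =
  ⊕-isUltrafilter (InF⇒isUltrafilter p-uf u∈F) (λ n → InF⇒isUltrafilter p-uf (us∈F n))

record BlockSum (X A : Subset) (As : ℕ → Subset) (c : ℕ) : Set where
  field
    left right : List ℕ
    left≢[]    : left ≢ []
    right≢[]   : right ≢ []
    increasing : FinNESub X (left ++ right)
    A∋left     : A (sum left)
    As∋right   : As (sum left) (sum right)
    sum≡       : sum left + sum right ≡ c

BlockSum⊆FS : ∀ {X A As} c → BlockSum X A As c → FS X c
BlockSum⊆FS c b = left ++ right , increasing , trans (sum-++ left right) sum≡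
  where open BlockSum b

record BlockSplit (A : Subset) (As : ℕ → Subset) (g : ℕ → ℕ) (m : ℕ) : Set where
  constructor split
  field
    i j    : ℕ
    m≡i+j  : m ≡ i + j
    1≤i    : 1 ≤ i
    1≤j    : 1 ≤ j
    A∋i    : A (psum g i)
    As∋j   : As (psum g i) (psum (g ∘ (i +_)) j)

BlockSplit⇒BlockSum : ∀ {X A As g m} → (∀ k → X (g k)) → StrictlyIncreasing g →
  BlockSplit A As g m → BlockSum X A As (psum g m)
BlockSplit⇒BlockSum {X} {A} {As} {g} Xg g↑ (split i j refl 1≤i 1≤j A∋i As∋j) = record
  { left       = applyUpTo g i
  ; right      = applyUpTo (g ∘ (i +_)) j
  ; left≢[]    = applyUpTo-≢[] g 1≤i
  ; right≢[]   = applyUpTo-≢[] (g ∘ (i +_)) 1≤j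
  ; increasing = subst (FinNESub X) (applyUpTo-++ g i j)
                   (applyUpTo-FinNESub Xg g↑ (≤-trans 1≤i (m≤m+n i j)))
  ; A∋left     = subst A (sym (sum-applyUpTo g i)) A∋i
  ; As∋right   = subst₂ As (sym (sum-applyUpTo g i)) (sym (sum-applyUpTo (g ∘ (i +_)) j)) As∋j
  ; sum≡       = begin
      sum (applyUpTo g i) + sum (applyUpTo (g ∘ (i +_)) j) ≡⟨ sum-++ (applyUpTo g i) _ ⟨
      sum (applyUpTo g i ++ applyUpTo (g ∘ (i +_)) j)      ≡⟨ cong sum (applyUpTo-++ g i j) ⟨
      sum (applyUpTo g (i + j))                            ≡⟨ sum-applyUpTo g (i + j) ⟩
      psum g (i + j)                                       ∎
  }

BlockSum⇒BlockSplit : ∀ {X A As g m} → UniquenessOfSums X →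
  (∀ k → X (g k)) → StrictlyIncreasing g → 1 ≤ m →
  BlockSum X A As (psum g m) → BlockSplit A As g m
BlockSum⇒BlockSplit {A = A} {As} {g} {m} uos Xg g↑ 1≤m b =
  split (length left) (length right) m≡ (≢[]⇒1≤length left≢[]) (≢[]⇒1≤length right≢[])
    (subst A sum-left A∋left) (subst₂ As sum-left sum-right As∋right)
  where
  open BlockSum b

  whole : left ++ right ≡ applyUpTo g m
  whole = UniquenessOfSums⇒≡applyUpTo uos Xg g↑ 1≤m increasing
            (trans (sum-++ left right) sum≡)

  sum-left : sum left ≡ psum g (length left)
  sum-left = trans (cong sum (proj₁ (applyUpTo-++⁻ g left right whole)))
                   (sum-applyUpTo g (length left))

  sum-right : sum right ≡ psum (g ∘ (length left +_)) (length right)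
  sum-right = trans (cong sum (proj₂ (applyUpTo-++⁻ g left right whole)))
                    (sum-applyUpTo (g ∘ (length left +_)) (length right))

  m≡ : m ≡ length left + length right
  m≡ = begin
    m                          ≡⟨ length-applyUpTo g m ⟨
    length (applyUpTo g m)     ≡⟨ cong length whole ⟨
    length (left ++ right)     ≡⟨ length-++ left ⟩
    length left + length right ∎

BlockSplit-unique : ∀ {A As g i j m} →
  (∀ i′ → 1 ≤ i′ → A (psum g i′) → i′ ≡ i) →
  (∀ j′ → 1 ≤ j′ → As (psum g i) (psum (g ∘ (i +_)) j′) → j′ ≡ j) →
  BlockSplit A As g m → m ≡ i + j
BlockSplit-unique i-unique j-unique (split i′ j′ refl 1≤i′ 1≤j′ A∋i′ As∋j′)
  with refl ← i-unique i′ 1≤i′ A∋i′ = cong (i′ +_) (j-unique j′ 1≤j′ As∋j′)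

BlockSum-adequate : ∀ {x A As} → StrictlyIncreasing x → UniquenessOfSums (range x) →
  Adequate x A → (∀ a → Adequate x (As a)) → Adequate x (BlockSum (range x) A As)
BlockSum-adequate {x} {A} {As} x↑ uos (_ , A-unique) As-adequate = BlockSum⊆FS , unique-block
  where
  unique-block : (n : ℕ → ℕ) → StrictlyIncreasing n →
    Σ ℕ λ m → (1 ≤ m) × BlockSum (range x) A As (psum (x ∘ n) m) ×
      (∀ m′ → 1 ≤ m′ → BlockSum (range x) A As (psum (x ∘ n) m′) → m′ ≡ m)
  unique-block n n↑
    with i , 1≤i , A∋i , i-unique ← A-unique n n↑
    with j , 1≤j , As∋j , j-unique ← proj₂ (As-adequate (psum (x ∘ n) i)) (n ∘ (i +_))
                                        (∘-strictlyIncreasing n↑ (+-strictlyIncreasing i))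
    = i + j , ≤-trans 1≤i (m≤m+n i j) ,
      BlockSplit⇒BlockSum xn∈X xn↑ (split i j refl 1≤i 1≤j A∋i As∋j) ,
      λ m′ 1≤m′ → BlockSplit-unique i-unique j-unique ∘ BlockSum⇒BlockSplit uos xn∈X xn↑ 1≤m′
    where
    xn∈X : ∀ k → range x (x (n k))
    xn∈X k = n k , refl

    xn↑ : StrictlyIncreasing (x ∘ n)
    xn↑ = ∘-strictlyIncreasing x↑ n↑

⊕-BlockSum : ∀ {X A As u us} → IsUltrafilter u → (∀ n → IsUltrafilter (us n)) →
  (∀ a → A a → FS X a) → u A → (∀ n → us n (As n)) → (∀ n → us n (FS (Above n X))) →
  ⊕ u us (BlockSum X A As)
⊕-BlockSum {X} {A} {As} u-uf us-uf A⊆FS u∋A us∋As us∋FS =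
  upward u-uf _ _
    (λ n A∋n → upward (us-uf n) _ _ (glue n A∋n) (meet (us-uf n) _ _ (us∋As n) (us∋FS n)))
    u∋A
  where
  open IsUltrafilter

  glue : ∀ n → A n → ∀ m → As n m × FS (Above n X) m → BlockSum X A As (n + m)
  glue n A∋n m (As∋m , ys , ys∈ , refl) with A⊆FS n A∋n
  ... | xs , xs∈ , refl = record
    { left = xs ; right = ys ; left≢[] = proj₁ xs∈ ; right≢[] = proj₁ ys∈
    ; increasing = FinNESub-++ xs∈ ys∈ ; A∋left = A∋n ; As∋right = As∋m ; sum≡ = refl }

⊕-FS : ∀ {Y u us} → IsUltrafilter u → (∀ n → IsUltrafilter (us n)) →
  u (FS Y) → (∀ n → us n (FS (Above n Y))) → ⊕ u us (FS Y)
⊕-FS u-uf us-uf u∋FS us∋FS =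
  upward u-uf _ _ (λ n FS∋n → upward (us-uf n) _ _ (λ m → FS-+ FS∋n) (us∋FS n)) u∋FS
  where open IsUltrafilter

⊕-adequateUF : ∀ {x u us} → StrictlyIncreasing x → UniquenessOfSums (range x) →
  IsUltrafilter u → (∀ n → IsUltrafilter (us n)) →
  AdequateUF x u → (∀ n → AdequateUF x (us n)) → AdequateUF x (⊕ u us)
⊕-adequateUF {x} {us = us} x↑ uos u-uf us-uf ((A , A-adequate , u∋A) , u∋FS) us-adequateUF =
  ( BlockSum (range x) A As
  , BlockSum-adequate x↑ uos A-adequate As-adequate
  , ⊕-BlockSum u-uf us-uf (proj₁ A-adequate) u∋A us∋As
      (λ n → us∋FS n (Above n (range x)) (Above-cofinite n (CofiniteSubset-refl (range x))))
  ) ,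
  λ Y Y-cofinite →
    ⊕-FS u-uf us-uf (u∋FS Y Y-cofinite) (λ n → us∋FS n (Above n Y) (Above-cofinite n Y-cofinite))
  where
  As : ℕ → Subset
  As n = proj₁ (proj₁ (us-adequateUF n))

  As-adequate : ∀ n → Adequate x (As n)
  As-adequate n = proj₁ (proj₂ (proj₁ (us-adequateUF n)))

  us∋As : ∀ n → us n (As n)
  us∋As n = proj₂ (proj₂ (proj₁ (us-adequateUF n)))

  us∋FS : ∀ n (Y : Subset) → CofiniteSubset Y (range x) → us n (FS Y)
  us∋FS n = proj₂ (us-adequateUF n)

proposition2p15 : (x : ℕ → ℕ) → StrictlyIncreasing x →
    UniquenessOfSums (range x) →
    (p : SetFamily) → IsUltrafilter p → AdequateUF x p →
    (q : SetFamily) → InF p q → AdequateUF x q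
proposition2p15 x x↑ uos p p-uf p-adequateUF .p base = p-adequateUF
proposition2p15 x x↑ uos p p-uf p-adequateUF _ (step u us u∈F us∈F) =
  ⊕-adequateUF x↑ uos
    (InF⇒isUltrafilter p-uf u∈F) (λ n → InF⇒isUltrafilter p-uf (us∈F n))
    (proposition2p15 x x↑ uos p p-uf p-adequateUF u u∈F)
    (λ n → proposition2p15 x x↑ uos p p-uf p-adequateUF (us n) (us∈F n))
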